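{- Let $n\geq 2$ and let $L=(a_1,a_2,a_3)$ be a sequence of three natural numbers such that $UD_n(L)\neq\emptyset$. Then $\rho_{n,L}>\alpha_n$, where $\alpha_2=1/6$ and $\alpha_n=(n-2)/n$ for $n>2$.
   Context: Let $X$ be an alphabet with $n$ letters and $X^*$ the set of words over $X$. A code over $X$ is a finite sequence $C=(v_1,\ldots,v_m)$ of words over $X$ such that every $w\in X^*$ has at most one factorization into code-words: if $w=v_{i_1}\cdots v_{i_l}=v_{j_1}\cdots v_{j_{l'}}$ with $l,l'\geq 1$, then $l=l'$ and $i_t=j_t$ for all $t$. A code $(v_1,\ldots,v_m)$ is a prefix code if for all $i,j$, $v_i$ is a prefix of $v_j$ iff $i=j$. For a finite sequence $L=(a_1,\ldots,a_m)$ of natural numbers, $UD_n(L)$ is the set of codes $(v_1,\ldots,v_m)$ over $X$ with $|v_i|=a_i$ for all $i$, $PR_n(L)\subseteq UD_n(L)$ is the subset of prefix codes, and $\rho_{n,L}=|PR_n(L)|/|UD_n(L)|$. -}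

module Defs where

open import Data.Nat using (ℕ; zero; suc; _*_; _∸_; _<_; _≤_)
open import Data.Fin using (Fin)
open import Data.List using (List; []; _++_; concat; map; length)
open import Data.List.Membership.Propositional using (_∈_)
open import Data.List.Relation.Unary.Unique.Propositional using (Unique)
open import Data.Vec using (Vec; lookup)
open import Data.Product using (Σ; ∃; _×_; _,_)
open import Function.Bundles using (_⇔_)
open import Relation.Binary.PropositionalEquality using (_≡_; _≢_)

Word : ℕ → Set
Word n = List (Fin n)

Seq : ℕ → ℕ → Set
Seq n m = Vec (Word n) m

concatIdx : ∀ {n m} → Seq n m → List (Fin m) → Word n
concatIdx C is = concat (map (lookup C) is)

IsCode : ∀ {n m} → Seq n m → Set
IsCode {n} {m} C =
  (is js : List (Fin m)) → is ≢ [] → js ≢ [] →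
  concatIdx C is ≡ concatIdx C js → is ≡ js

IsPrefix : ∀ {n} → Word n → Word n → Set
IsPrefix {n} u v = Σ (Word n) λ s → u ++ s ≡ v

IsPrefixCode : ∀ {n m} → Seq n m → Set
IsPrefixCode {n} {m} C =
  IsCode C × ((i j : Fin m) → IsPrefix (lookup C i) (lookup C j) ⇔ (i ≡ j))

HasLengths : ∀ {n m} → Vec ℕ m → Seq n m → Set
HasLengths {n} {m} L C = (i : Fin m) → length (lookup C i) ≡ lookup L i

UD : (n : ℕ) → ∀ {m} → Vec ℕ m → Seq n m → Set
UD n L C = HasLengths L C × IsCode C

PR : (n : ℕ) → ∀ {m} → Vec ℕ m → Seq n m → Set
PR n L C = HasLengths L C × IsPrefixCode C

HasCard : {A : Set} → (A → Set) → ℕ → Set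
HasCard {A} S k =
  Σ (List A) λ xs → Unique xs × ((x : A) → (x ∈ xs) ⇔ S x) × length xs ≡ k

-- α_n = alphaNum n / alphaDen n : α_2 = 1/6, α_n = (n-2)/n for n > 2.
alphaNum : ℕ → ℕ
alphaNum 2 = 1
alphaNum n = n ∸ 2

alphaDen : ℕ → ℕ
alphaDen 2 = 6
alphaDen n = n

-- ρ = p / u > α_n, cross-multiplied (u, alphaDen n > 0 in the relevant cases).
RatioExceedsAlpha : ℕ → ℕ → ℕ → Set
RatioExceedsAlpha n p u = alphaNum n * u < p * alphaDen n

-- Permuting the code words preserves codes, prefix codes and their numbers, so the lengths may be
-- taken sorted: (a, a + d, a + d + e). Put N = n^a, D = n^d, E = n^e. Every code is one of the
-- N·ND·NDE triples of words of these lengths, and every triple in which no word is a prefix of a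
-- later one is a prefix code; a union bound gives at least N(ND − D)(NDE − DE − E) of these. Hence
-- ρ ≥ (1 − 1/N)(1 − 1/N − 1/(ND)), which beats α_n except when a = b = 1, or n = 2 and (a, b) = (1, 2).
-- There v₁ is a single letter and a code has v₂ ≠ v₁^b, v₃ ≠ v₁^c, so there are at most
-- n(n^b − 1)(n^c − 1) codes, which suffices; for n = 2 and a = b = 1 the letters v₁ ≠ v₂ form the
-- whole alphabet, so v₃ factorizes into them and no code exists.

module Submission where

open import Defs
open import Data.Bool using (if_then_else_)
open import Data.Empty using (⊥-elim)
open import Data.Fin using (Fin; zero; suc; _≟_; punchIn)
open import Data.Fin.Patterns using (0F; 1F; 2F)
open import Data.Fin.Permutation using (Permutation′; _⟨$⟩ʳ_)
import Data.Fin.Permutation as Perm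
open import Data.Fin.Properties using (punchInᵢ≢i)
open import Data.List
  using (List; []; _∷_; _++_; length; map; concat; replicate; filter; cartesianProductWith; allFin; tabulate)
open import Data.List.Properties
  using (≡-dec; length-++; length-map; ∷-injective; ∷-injectiveˡ; ∷-injectiveʳ; ++-identityʳ; ++-conicalˡ; ++-cancelˡ;
         map-++; map-∘; map-tabulate; map-cong; map-replicate; map-injective)
open import Data.List.Membership.Propositional using (_∈_)
open import Data.List.Membership.Propositional.Properties
  using (∈-∃++; ∈-++⁻; ∈-++⁺ˡ; ∈-++⁺ʳ; ∈-allFin; ∈-map⁺; ∈-map⁻; ∈-filter⁺; ∈-filter⁻;
         ∈-cartesianProductWith⁺; ∈-cartesianProductWith⁻)
open import Data.List.Relation.Unary.Any using (here; there)
import Data.List.Relation.Unary.All as All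
import Data.List.Relation.Unary.AllPairs as AllPairs
open import Data.List.Relation.Unary.Unique.Propositional using (Unique)
import Data.List.Relation.Unary.Unique.Propositional.Properties as Unique
open import Data.Nat using (ℕ; zero; suc; _+_; _*_; _∸_; _^_; _≤_; _<_; z≤n; s≤s; z<s; NonZero; >-nonZero⁻¹)
open import Data.Nat.ListAction using () renaming (sum to sumˡ)
open import Data.Nat.ListAction.Properties using (sum-++)
open import Data.Nat.Properties hiding (_≟_)
open import Algebra.Properties.Semiring.Sum +-*-semiring
  using (sum; sum-syntax; sum-cong-≗; ∑-distrib-+; *-distribˡ-sum; sum-remove; sum-replicate-zero)
open import Data.Nat.Tactic.RingSolver using (solve-∀)
open import Data.Product using (∃; _×_; _,_)
open import Data.Sum using (_⊎_; inj₁; inj₂)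
import Data.Sum as Sum
open import Data.Unit using (tt)
open import Data.Vec using (Vec; lookup) renaming ([] to []ᵥ; _∷_ to _∷ᵥ_)
import Data.Vec as Vec using (sum; tabulate)
import Data.Vec.Properties as Vec
open import Function using (_∘_; id)
open import Function.Bundles using (Equivalence; mk⇔; Inverse; Injection; _↔_; mk↔ₛ′)
open import Function.Properties.Inverse using (Inverse⇒Injection)
open import Relation.Binary.PropositionalEquality
open import Relation.Nullary using (¬_; Dec; yes; no; does; ¬?; _×-dec_)

-- Indicators and finite sums

𝟙 : ∀ {p} {P : Set p} → Dec P → ℕ
𝟙 d = if does d then 1 else 0

𝟙-yes : ∀ {p} {P : Set p} (d : Dec P) → P → 𝟙 d ≡ 1
𝟙-yes (yes _) _ = refl
𝟙-yes (no ¬p) p = ⊥-elim (¬p p)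

𝟙-no : ∀ {p} {P : Set p} (d : Dec P) → ¬ P → 𝟙 d ≡ 0
𝟙-no (yes p) ¬p = ⊥-elim (¬p p)
𝟙-no (no _) _ = refl

𝟙-¬ : ∀ {p} {P : Set p} (d : Dec P) → 𝟙 (¬? d) + 𝟙 d ≡ 1
𝟙-¬ (yes _) = refl
𝟙-¬ (no _) = refl

𝟙-× : ∀ {p q} {P : Set p} {Q : Set q} (d : Dec P) (e : Dec Q) → 𝟙 (d ×-dec e) ≡ 𝟙 d * 𝟙 e
𝟙-× (yes _) e = sym (+-identityʳ (𝟙 e))
𝟙-× (no _) e = refl

𝟙-union-bound : ∀ {p q} {P : Set p} {Q : Set q} (d : Dec P) (e : Dec Q) →
  1 ≤ (𝟙 d + 𝟙 e) + 𝟙 (¬? d ×-dec ¬? e)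
𝟙-union-bound (yes _) _ = s≤s z≤n
𝟙-union-bound (no _) (yes _) = s≤s z≤n
𝟙-union-bound (no _) (no _) = s≤s z≤n

sum-mono-≤ : ∀ {m} {f g : Fin m → ℕ} → (∀ i → f i ≤ g i) → sum f ≤ sum g
sum-mono-≤ {zero} f≤g = z≤n
sum-mono-≤ {suc m} f≤g = +-mono-≤ (f≤g zero) (sum-mono-≤ (f≤g ∘ suc))

sum-const : ∀ m c → ∑[ i < m ] c ≡ m * c
sum-const zero c = refl
sum-const (suc m) c = cong (c +_) (sum-const m c)

sum-one-point : ∀ {m} (f : Fin m → ℕ) (i : Fin m) → (∀ j → j ≢ i → f j ≡ 0) → sum f ≡ f i
sum-one-point {suc m} f i f≡0 = begin
  sum f                                ≡⟨ sum-remove {i = i} f ⟩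
  f i + ∑[ j < m ] f (punchIn i j)     ≡⟨ cong (f i +_) (sum-cong-≗ (λ j → f≡0 _ (punchInᵢ≢i i j))) ⟩
  f i + ∑[ j < m ] 0                    ≡⟨ cong (f i +_) (sum-replicate-zero m) ⟩
  f i + 0                              ≡⟨ +-identityʳ (f i) ⟩
  f i                                  ∎
  where open ≡-Reasoning

sumˡ-tabulate : ∀ {m} (f : Fin m → ℕ) → sumˡ (tabulate f) ≡ sum f
sumˡ-tabulate {zero} f = refl
sumˡ-tabulate {suc m} f = cong (f zero +_) (sumˡ-tabulate (f ∘ suc))

sumˡ-map-allFin : ∀ m (f : Fin m → ℕ) → sumˡ (map f (allFin m)) ≡ sum f
sumˡ-map-allFin m f = trans (cong sumˡ (map-tabulate id f)) (sumˡ-tabulate f)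

sumˡ-map-cartesianProductWith : ∀ {A B C : Set} (f : C → ℕ) (g : A → B → C) xs ys →
  sumˡ (map f (cartesianProductWith g xs ys)) ≡ sumˡ (map (λ x → sumˡ (map (f ∘ g x) ys)) xs)
sumˡ-map-cartesianProductWith f g [] ys = refl
sumˡ-map-cartesianProductWith f g (x ∷ xs) ys = begin
  sumˡ (map f (map (g x) ys ++ cartesianProductWith g xs ys))
    ≡⟨ cong sumˡ (map-++ f (map (g x) ys) _) ⟩
  sumˡ (map f (map (g x) ys) ++ map f (cartesianProductWith g xs ys))
    ≡⟨ sum-++ (map f (map (g x) ys)) _ ⟩
  sumˡ (map f (map (g x) ys)) + sumˡ (map f (cartesianProductWith g xs ys))
    ≡⟨ cong₂ _+_ (cong sumˡ (sym (map-∘ ys))) (sumˡ-map-cartesianProductWith f g xs ys) ⟩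
  sumˡ (map (f ∘ g x) ys) + sumˡ (map (λ x → sumˡ (map (f ∘ g x) ys)) xs)
    ∎
  where open ≡-Reasoning

length-filter-𝟙 : ∀ {A : Set} {p} {P : A → Set p} (P? : ∀ x → Dec (P x)) xs →
  length (filter P? xs) ≡ sumˡ (map (𝟙 ∘ P?) xs)
length-filter-𝟙 P? [] = refl
length-filter-𝟙 P? (x ∷ xs) with P? x
... | yes _ = cong suc (length-filter-𝟙 P? xs)
... | no _ = length-filter-𝟙 P? xs

Unique-⊆⇒length-≤ : ∀ {A : Set} {xs ys : List A} → Unique xs → (∀ {x} → x ∈ xs → x ∈ ys) →
  length xs ≤ length ys
Unique-⊆⇒length-≤ {xs = []} _ _ = z≤n
Unique-⊆⇒length-≤ {xs = x ∷ xs} (x∉xs AllPairs.∷ xs!) xs⊆ys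
  with ys₁ , ys₂ , refl ← ∈-∃++ (xs⊆ys (here refl)) = begin
  suc (length xs)              ≤⟨ s≤s (Unique-⊆⇒length-≤ xs! xs⊆ys₁ys₂) ⟩
  suc (length (ys₁ ++ ys₂))    ≡⟨ cong suc (length-++ ys₁) ⟩
  suc (length ys₁ + length ys₂) ≡⟨ +-suc (length ys₁) _ ⟨
  length ys₁ + suc (length ys₂) ≡⟨ length-++ ys₁ ⟨
  length (ys₁ ++ x ∷ ys₂)      ∎
  where
  open ≤-Reasoning
  xs⊆ys₁ys₂ : ∀ {z} → z ∈ xs → z ∈ ys₁ ++ ys₂
  xs⊆ys₁ys₂ z∈xs with ∈-++⁻ ys₁ (xs⊆ys (there z∈xs))
  ... | inj₁ z∈ys₁ = ∈-++⁺ˡ z∈ys₁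
  ... | inj₂ (here refl) = ⊥-elim (All.lookup x∉xs z∈xs refl)
  ... | inj₂ (there z∈ys₂) = ∈-++⁺ʳ ys₁ z∈ys₂

-- Words and their counts

module _ {n : ℕ} where

  infix 4 _≟ʷ_ _⊑?_

  _≟ʷ_ : (u v : Word n) → Dec (u ≡ v)
  _≟ʷ_ = ≡-dec _≟_

  _⊑?_ : (u v : Word n) → Dec (IsPrefix u v)
  [] ⊑? v = yes (v , refl)
  (x ∷ u) ⊑? [] = no λ ()
  (x ∷ u) ⊑? (y ∷ v) with x ≟ y | u ⊑? v
  ... | yes refl | yes (s , refl) = yes (s , refl)
  ... | yes refl | no u⋢v = no λ (s , e) → u⋢v (s , ∷-injectiveʳ e)
  ... | no x≢y | _ = no λ (_ , e) → x≢y (∷-injectiveˡ e)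

  ⊑-longer⇒≡ : ∀ {u v : Word n} → IsPrefix u v → length v ≤ length u → u ≡ v
  ⊑-longer⇒≡ {[]} ([] , refl) _ = refl
  ⊑-longer⇒≡ {x ∷ u} (s , refl) (s≤s |u++s|≤|u|) = cong (x ∷_) (⊑-longer⇒≡ (s , refl) |u++s|≤|u|)

  ⊑-reverse : ∀ {u v : Word n} → IsPrefix v u → length u ≤ length v → IsPrefix u v
  ⊑-reverse v⊑u |u|≤|v| with refl ← ⊑-longer⇒≡ v⊑u |u|≤|v| = [] , ++-identityʳ _

  ++-comparable : ∀ (u v : Word n) {r r′} → u ++ r ≡ v ++ r′ → IsPrefix u v ⊎ IsPrefix v u
  ++-comparable [] v _ = inj₁ (v , refl)
  ++-comparable (x ∷ u) [] _ = inj₂ (x ∷ u , refl)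
  ++-comparable (x ∷ u) (y ∷ v) eq with refl , eq′ ← ∷-injective eq =
    Sum.map (λ (s , e) → s , cong (x ∷_) e) (λ (s , e) → s , cong (x ∷_) e) (++-comparable u v eq′)

  ++-equal-length : ∀ {u v r r′ : Word n} → length u ≡ length v → u ++ r ≡ v ++ r′ → u ≡ v
  ++-equal-length {u} {v} |u|≡|v| eq with ++-comparable u v eq
  ... | inj₁ u⊑v = ⊑-longer⇒≡ u⊑v (≤-reflexive (sym |u|≡|v|))
  ... | inj₂ v⊑u = sym (⊑-longer⇒≡ v⊑u (≤-reflexive |u|≡|v|))

  length≡0⇒[] : ∀ {v : Word n} → length v ≡ 0 → v ≡ []
  length≡0⇒[] {[]} refl = refl

  length≡1⇒[x] : ∀ {v : Word n} → length v ≡ 1 → ∃ λ x → v ≡ x ∷ []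
  length≡1⇒[x] {x ∷ []} refl = x , refl

  infixr 8 _^ʷ_

  _^ʷ_ : Word n → ℕ → Word n
  w ^ʷ k = concat (replicate k w)

  length-^ʷ : ∀ (w : Word n) k → length (w ^ʷ k) ≡ k * length w
  length-^ʷ w zero = refl
  length-^ʷ w (suc k) = trans (length-++ w) (cong (length w +_) (length-^ʷ w k))

  Σ-words : ℕ → (Word n → ℕ) → ℕ
  Σ-words zero f = f []
  Σ-words (suc k) f = ∑[ x < n ] Σ-words k (f ∘ (x ∷_))

  Σ-words-cong : ∀ k {f g : Word n → ℕ} → (∀ v → length v ≡ k → f v ≡ g v) → Σ-words k f ≡ Σ-words k g
  Σ-words-cong zero f≡g = f≡g [] refl
  Σ-words-cong (suc k) f≡g = sum-cong-≗ {n} λ x → Σ-words-cong k λ v |v|≡k → f≡g (x ∷ v) (cong suc |v|≡k)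

  Σ-words-mono-≤ : ∀ k {f g : Word n → ℕ} → (∀ v → length v ≡ k → f v ≤ g v) → Σ-words k f ≤ Σ-words k g
  Σ-words-mono-≤ zero f≤g = f≤g [] refl
  Σ-words-mono-≤ (suc k) f≤g = sum-mono-≤ λ x → Σ-words-mono-≤ k λ v |v|≡k → f≤g (x ∷ v) (cong suc |v|≡k)

  Σ-words-distrib-+ : ∀ k (f g : Word n → ℕ) → Σ-words k (λ v → f v + g v) ≡ Σ-words k f + Σ-words k g
  Σ-words-distrib-+ zero f g = refl
  Σ-words-distrib-+ (suc k) f g =
    trans (sum-cong-≗ {n} λ x → Σ-words-distrib-+ k (f ∘ (x ∷_)) (g ∘ (x ∷_))) (∑-distrib-+ {n} _ _)

  *-distribˡ-Σ-words : ∀ k c (f : Word n → ℕ) → c * Σ-words k f ≡ Σ-words k (λ v → c * f v)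
  *-distribˡ-Σ-words zero c f = refl
  *-distribˡ-Σ-words (suc k) c f =
    trans (*-distribˡ-sum {n} c _) (sum-cong-≗ {n} λ x → *-distribˡ-Σ-words k c (f ∘ (x ∷_)))

  Σ-words-const : ∀ k c → Σ-words k (λ _ → c) ≡ n ^ k * c
  Σ-words-const zero c = sym (+-identityʳ c)
  Σ-words-const (suc k) c = begin
    ∑[ x < n ] Σ-words k (λ _ → c)   ≡⟨ sum-cong-≗ {n} (λ _ → Σ-words-const k c) ⟩
    ∑[ x < n ] (n ^ k * c)           ≡⟨ sum-const n (n ^ k * c) ⟩
    n * (n ^ k * c)                  ≡⟨ *-assoc n (n ^ k) c ⟨
    n * n ^ k * c                    ∎
    where open ≡-Reasoning

  Σ-words-zero : ∀ k → Σ-words k (λ _ → 0) ≡ 0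
  Σ-words-zero k = trans (Σ-words-const k 0) (*-zeroʳ (n ^ k))

  Σ-words-++ : ∀ j k (f : Word n → ℕ) → Σ-words (j + k) f ≡ Σ-words j (λ u → Σ-words k (λ s → f (u ++ s)))
  Σ-words-++ zero k f = refl
  Σ-words-++ (suc j) k f = sum-cong-≗ {n} λ x → Σ-words-++ j k (f ∘ (x ∷_))

  Σ-words-one-point : ∀ {k} (f : Word n → ℕ) (w : Word n) → length w ≡ k →
    (∀ v → length v ≡ k → v ≢ w → f v ≡ 0) → Σ-words k f ≡ f w
  Σ-words-one-point {zero} f [] _ _ = refl
  Σ-words-one-point {suc k} f (y ∷ w) refl f≡0 = begin
    ∑[ x < n ] Σ-words k (f ∘ (x ∷_))   ≡⟨ sum-one-point _ y vanishes ⟩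
    Σ-words k (f ∘ (y ∷_))              ≡⟨ Σ-words-one-point (f ∘ (y ∷_)) w refl (λ v |v|≡k v≢w →
                                             f≡0 (y ∷ v) (cong suc |v|≡k) (v≢w ∘ ∷-injectiveʳ)) ⟩
    f (y ∷ w)                           ∎
    where
    open ≡-Reasoning
    vanishes : ∀ x → x ≢ y → Σ-words k (f ∘ (x ∷_)) ≡ 0
    vanishes x x≢y = begin
      Σ-words k (f ∘ (x ∷_))
        ≡⟨ Σ-words-cong k (λ v |v|≡k → f≡0 (x ∷ v) (cong suc |v|≡k) (x≢y ∘ ∷-injectiveˡ)) ⟩
      Σ-words k (λ _ → 0)
        ≡⟨ Σ-words-zero k ⟩
      0 ∎

  count-¬ : ∀ k {p} {P : Word n → Set p} (P? : ∀ v → Dec (P v)) →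
    Σ-words k (λ v → 𝟙 (¬? (P? v))) ≡ n ^ k ∸ Σ-words k (λ v → 𝟙 (P? v))
  count-¬ k P? = trans (sym (m+n∸n≡m _ (Σ-words k (𝟙 ∘ P?)))) (cong (_∸ Σ-words k (𝟙 ∘ P?)) complementary)
    where
    complementary : Σ-words k (λ v → 𝟙 (¬? (P? v))) + Σ-words k (𝟙 ∘ P?) ≡ n ^ k
    complementary = begin
      Σ-words k (λ v → 𝟙 (¬? (P? v))) + Σ-words k (𝟙 ∘ P?)   ≡⟨ Σ-words-distrib-+ k _ _ ⟨
      Σ-words k (λ v → 𝟙 (¬? (P? v)) + 𝟙 (P? v))           ≡⟨ Σ-words-cong k (λ v _ → 𝟙-¬ (P? v)) ⟩
      Σ-words k (λ _ → 1)                                   ≡⟨ Σ-words-const k 1 ⟩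
      n ^ k * 1                                             ≡⟨ *-identityʳ (n ^ k) ⟩
      n ^ k                                                 ∎
      where open ≡-Reasoning

  count-≡ : ∀ {k} (w : Word n) → length w ≡ k → Σ-words k (λ v → 𝟙 (v ≟ʷ w)) ≡ 1
  count-≡ w |w|≡k =
    trans (Σ-words-one-point _ w |w|≡k (λ v _ v≢w → 𝟙-no (v ≟ʷ w) v≢w)) (𝟙-yes (w ≟ʷ w) refl)

  count-≢ : ∀ {k} (w : Word n) → length w ≡ k → Σ-words k (λ v → 𝟙 (¬? (v ≟ʷ w))) ≡ n ^ k ∸ 1
  count-≢ {k} w |w|≡k = trans (count-¬ k (_≟ʷ w)) (cong (n ^ k ∸_) (count-≡ w |w|≡k))

  count-⊑ : ∀ {j} (w : Word n) → length w ≡ j → ∀ k → Σ-words (j + k) (λ v → 𝟙 (w ⊑? v)) ≡ n ^ k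
  count-⊑ {j} w |w|≡j k = begin
    Σ-words (j + k) (λ v → 𝟙 (w ⊑? v))
      ≡⟨ Σ-words-++ j k _ ⟩
    Σ-words j (λ u → Σ-words k (λ s → 𝟙 (w ⊑? (u ++ s))))
      ≡⟨ Σ-words-one-point _ w |w|≡j vanishes ⟩
    Σ-words k (λ s → 𝟙 (w ⊑? (w ++ s)))
      ≡⟨ Σ-words-cong k (λ s _ → 𝟙-yes (w ⊑? (w ++ s)) (s , refl)) ⟩
    Σ-words k (λ _ → 1)
      ≡⟨ trans (Σ-words-const k 1) (*-identityʳ (n ^ k)) ⟩
    n ^ k ∎
    where
    open ≡-Reasoning
    vanishes : ∀ u → length u ≡ j → u ≢ w → Σ-words k (λ s → 𝟙 (w ⊑? (u ++ s))) ≡ 0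
    vanishes u |u|≡j u≢w = trans
      (Σ-words-cong k λ s _ → 𝟙-no (w ⊑? (u ++ s)) λ (_ , e) →
        u≢w (sym (++-equal-length (trans |w|≡j (sym |u|≡j)) e)))
      (Σ-words-zero k)

  count-⋢ : ∀ {j} (w : Word n) → length w ≡ j → ∀ k →
    Σ-words (j + k) (λ v → 𝟙 (¬? (w ⊑? v))) ≡ n ^ (j + k) ∸ n ^ k
  count-⋢ {j} w |w|≡j k = trans (count-¬ (j + k) (w ⊑?_)) (cong (n ^ (j + k) ∸_) (count-⊑ w |w|≡j k))

  words : ℕ → List (Word n)
  words zero = [] ∷ []
  words (suc k) = cartesianProductWith _∷_ (allFin n) (words k)

  words-unique : ∀ k → Unique (words k)
  words-unique zero = All.[] AllPairs.∷ AllPairs.[]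
  words-unique (suc k) = Unique.cartesianProductWith⁺ _∷_ ∷-injective (Unique.allFin⁺ n) (words-unique k)

  ∈-words⁻ : ∀ {k v} → v ∈ words k → length v ≡ k
  ∈-words⁻ {zero} (here refl) = refl
  ∈-words⁻ {suc k} v∈words
    with _ , _ , _ , w∈words , refl ← ∈-cartesianProductWith⁻ _∷_ (allFin n) (words k) v∈words =
    cong suc (∈-words⁻ w∈words)

  ∈-words⁺ : ∀ {k v} → length v ≡ k → v ∈ words k
  ∈-words⁺ {v = []} refl = here refl
  ∈-words⁺ {v = x ∷ v} refl = ∈-cartesianProductWith⁺ _∷_ (∈-allFin x) (∈-words⁺ refl)

  sumˡ-map-words : ∀ k f → sumˡ (map f (words k)) ≡ Σ-words k f
  sumˡ-map-words zero f = +-identityʳ (f [])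
  sumˡ-map-words (suc k) f = begin
    sumˡ (map f (words (suc k)))
      ≡⟨ sumˡ-map-cartesianProductWith f _∷_ (allFin n) (words k) ⟩
    sumˡ (map (λ x → sumˡ (map (f ∘ (x ∷_)) (words k))) (allFin n))
      ≡⟨ cong sumˡ (map-cong (λ x → sumˡ-map-words k (f ∘ (x ∷_))) (allFin n)) ⟩
    sumˡ (map (λ x → Σ-words k (f ∘ (x ∷_))) (allFin n))
      ≡⟨ sumˡ-map-allFin n _ ⟩
    Σ-words (suc k) f ∎
    where open ≡-Reasoning

  Σ-seqs : ∀ {m} → Vec ℕ m → (Seq n m → ℕ) → ℕ
  Σ-seqs []ᵥ F = F []ᵥ
  Σ-seqs (a ∷ᵥ L) F = Σ-words a (λ v → Σ-seqs L (F ∘ (v ∷ᵥ_)))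

  seqs : ∀ {m} → Vec ℕ m → List (Seq n m)
  seqs []ᵥ = []ᵥ ∷ []
  seqs (a ∷ᵥ L) = cartesianProductWith _∷ᵥ_ (words a) (seqs L)

  seqs-unique : ∀ {m} (L : Vec ℕ m) → Unique (seqs L)
  seqs-unique []ᵥ = All.[] AllPairs.∷ AllPairs.[]
  seqs-unique (a ∷ᵥ L) = Unique.cartesianProductWith⁺ _∷ᵥ_ Vec.∷-injective (words-unique a) (seqs-unique L)

  ∈-seqs⁻ : ∀ {m} {L : Vec ℕ m} {C} → C ∈ seqs L → HasLengths L C
  ∈-seqs⁻ {L = []ᵥ} _ ()
  ∈-seqs⁻ {L = a ∷ᵥ L} C∈seqs
    with _ , _ , v∈words , D∈seqs , refl ← ∈-cartesianProductWith⁻ _∷ᵥ_ (words a) (seqs L) C∈seqs = λ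
    { zero → ∈-words⁻ v∈words
    ; (suc i) → ∈-seqs⁻ {L = L} D∈seqs i }

  ∈-seqs⁺ : ∀ {m} {L : Vec ℕ m} {C} → HasLengths L C → C ∈ seqs L
  ∈-seqs⁺ {L = []ᵥ} {[]ᵥ} _ = here refl
  ∈-seqs⁺ {L = a ∷ᵥ L} {v ∷ᵥ C} lengths =
    ∈-cartesianProductWith⁺ _∷ᵥ_ (∈-words⁺ (lengths zero)) (∈-seqs⁺ {L = L} (lengths ∘ suc))

  sumˡ-map-seqs : ∀ {m} (L : Vec ℕ m) F → sumˡ (map F (seqs L)) ≡ Σ-seqs L F
  sumˡ-map-seqs []ᵥ F = +-identityʳ (F []ᵥ)
  sumˡ-map-seqs (a ∷ᵥ L) F = begin
    sumˡ (map F (seqs (a ∷ᵥ L)))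
      ≡⟨ sumˡ-map-cartesianProductWith F _∷ᵥ_ (words a) (seqs L) ⟩
    sumˡ (map (λ v → sumˡ (map (F ∘ (v ∷ᵥ_)) (seqs L))) (words a))
      ≡⟨ cong sumˡ (map-cong (λ v → sumˡ-map-seqs L (F ∘ (v ∷ᵥ_))) (words a)) ⟩
    sumˡ (map (λ v → Σ-seqs L (F ∘ (v ∷ᵥ_))) (words a))
      ≡⟨ sumˡ-map-words a _ ⟩
    Σ-seqs (a ∷ᵥ L) F ∎
    where open ≡-Reasoning

  Σ-seqs-1 : ∀ {m} (L : Vec ℕ m) → Σ-seqs L (λ _ → 1) ≡ n ^ Vec.sum L
  Σ-seqs-1 []ᵥ = refl
  Σ-seqs-1 (a ∷ᵥ L) = begin
    Σ-words a (λ _ → Σ-seqs L (λ _ → 1))   ≡⟨ Σ-words-cong a (λ _ _ → Σ-seqs-1 L) ⟩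
    Σ-words a (λ _ → n ^ Vec.sum L)        ≡⟨ Σ-words-const a _ ⟩
    n ^ a * n ^ Vec.sum L                  ≡⟨ ^-distribˡ-+-* n a _ ⟨
    n ^ (a + Vec.sum L)                    ∎
    where open ≡-Reasoning

  module _ {m} {L : Vec ℕ m} {S : Seq n m → Set} {p} {P : Seq n m → Set p} (P? : ∀ C → Dec (P C)) where

    card-≤-Σ-seqs : (∀ C → S C → HasLengths L C × P C) → ∀ {u} → HasCard S u → u ≤ Σ-seqs L (𝟙 ∘ P?)
    card-≤-Σ-seqs S⊆P (xs , xs! , ∈xs⇔S , refl) = begin
      length xs                      ≤⟨ Unique-⊆⇒length-≤ xs! xs⊆ ⟩
      length (filter P? (seqs L))    ≡⟨ length-filter-𝟙 P? (seqs L) ⟩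
      sumˡ (map (𝟙 ∘ P?) (seqs L))   ≡⟨ sumˡ-map-seqs L _ ⟩
      Σ-seqs L (𝟙 ∘ P?)              ∎
      where
      open ≤-Reasoning
      xs⊆ : ∀ {C} → C ∈ xs → C ∈ filter P? (seqs L)
      xs⊆ {C} C∈xs with lengths , PC ← S⊆P C (Equivalence.to (∈xs⇔S C) C∈xs) =
        ∈-filter⁺ P? (∈-seqs⁺ {L = L} lengths) PC

    Σ-seqs-≤-card : (∀ C → HasLengths L C → P C → S C) → ∀ {k} → HasCard S k → Σ-seqs L (𝟙 ∘ P?) ≤ k
    Σ-seqs-≤-card P⊆S (xs , _ , ∈xs⇔S , refl) = begin
      Σ-seqs L (𝟙 ∘ P?)              ≡⟨ sumˡ-map-seqs L _ ⟨
      sumˡ (map (𝟙 ∘ P?) (seqs L))   ≡⟨ length-filter-𝟙 P? (seqs L) ⟨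
      length (filter P? (seqs L))    ≤⟨ Unique-⊆⇒length-≤ (Unique.filter⁺ P? (seqs-unique L)) ⊆xs ⟩
      length xs                      ∎
      where
      open ≤-Reasoning
      ⊆xs : ∀ {C} → C ∈ filter P? (seqs L) → C ∈ xs
      ⊆xs {C} C∈filter with C∈seqs , PC ← ∈-filter⁻ P? C∈filter =
        Equivalence.from (∈xs⇔S C) (P⊆S C (∈-seqs⁻ {L = L} C∈seqs) PC)

-- Codes

module _ {n m : ℕ} (C : Seq n m) (code : IsCode C) where

  code-word-nonempty : ∀ i → lookup C i ≢ []
  code-word-nonempty i Cᵢ≡[] with () ← code (i ∷ []) (i ∷ i ∷ []) (λ ()) (λ ())
    (trans (cong (_++ []) Cᵢ≡[]) (sym (cong (λ w → w ++ w ++ []) Cᵢ≡[])))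

  code-word-not-power : ∀ {i j} → i ≢ j → ∀ k → lookup C j ≢ lookup C i ^ʷ k
  code-word-not-power i≢j zero = code-word-nonempty _
  code-word-not-power {i} {j} i≢j (suc k) Cⱼ≡Cᵢ^k =
    i≢j (sym (∷-injectiveˡ (code (j ∷ []) (replicate (suc k) i) (λ ()) (λ ()) factorizations)))
    where
    factorizations : concatIdx C (j ∷ []) ≡ concatIdx C (replicate (suc k) i)
    factorizations = begin
      lookup C j ++ []                          ≡⟨ ++-identityʳ (lookup C j) ⟩
      lookup C j                                ≡⟨ Cⱼ≡Cᵢ^k ⟩
      concat (replicate (suc k) (lookup C i))   ≡⟨ cong concat (map-replicate (lookup C) (suc k) i) ⟨
      concatIdx C (replicate (suc k) i)         ∎
      where open ≡-Reasoning

module _ {n m : ℕ} (C : Seq n m) where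

  prefix-free⇒unique-factorization : (∀ i → lookup C i ≢ []) →
    (∀ i j → IsPrefix (lookup C i) (lookup C j) → i ≡ j) →
    ∀ is js → concatIdx C is ≡ concatIdx C js → is ≡ js
  prefix-free⇒unique-factorization nonempty prefix-free = go
    where
    go : ∀ is js → concatIdx C is ≡ concatIdx C js → is ≡ js
    go [] [] _ = refl
    go [] (j ∷ js) e = ⊥-elim (nonempty j (++-conicalˡ _ _ (sym e)))
    go (i ∷ is) [] e = ⊥-elim (nonempty i (++-conicalˡ _ _ e))
    go (i ∷ is) (j ∷ js) e with ++-comparable (lookup C i) (lookup C j) e
    ... | inj₁ Cᵢ⊑Cⱼ with refl ← prefix-free i j Cᵢ⊑Cⱼ = cong (i ∷_) (go is js (++-cancelˡ (lookup C i) _ _ e))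
    ... | inj₂ Cⱼ⊑Cᵢ with refl ← prefix-free j i Cⱼ⊑Cᵢ = cong (i ∷_) (go is js (++-cancelˡ (lookup C i) _ _ e))

  concatIdx-spelling : (idx : Fin n → Fin m) → (∀ x → lookup C (idx x) ≡ x ∷ []) →
    ∀ w → concatIdx C (map idx w) ≡ w
  concatIdx-spelling idx spells [] = refl
  concatIdx-spelling idx spells (x ∷ w) = cong₂ _++_ (spells x) (concatIdx-spelling idx spells w)

other-letter : ∀ {x y z : Fin 2} → x ≢ y → z ≢ x → z ≡ y
other-letter {0F} {0F} x≢y _ = ⊥-elim (x≢y refl)
other-letter {0F} {1F} {0F} _ z≢x = ⊥-elim (z≢x refl)
other-letter {0F} {1F} {1F} _ _ = refl
other-letter {1F} {0F} {0F} _ _ = refl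
other-letter {1F} {0F} {1F} _ z≢x = ⊥-elim (z≢x refl)
other-letter {1F} {1F} x≢y _ = ⊥-elim (x≢y refl)

binary-letters-not-code : ∀ (x y : Fin 2) v₃ → ¬ IsCode ((x ∷ []) ∷ᵥ (y ∷ []) ∷ᵥ v₃ ∷ᵥ []ᵥ)
binary-letters-not-code x y [] code = code-word-nonempty ((x ∷ []) ∷ᵥ (y ∷ []) ∷ᵥ [] ∷ᵥ []ᵥ) code 2F refl
binary-letters-not-code x y v₃@(_ ∷ _) code =
  not-two v₃ (code (2F ∷ []) (map idx v₃) (λ ()) (λ ()) v₃-spelled)
  where
  C = (x ∷ []) ∷ᵥ (y ∷ []) ∷ᵥ v₃ ∷ᵥ []ᵥ
  x≢y : x ≢ y
  x≢y refl = code-word-not-power C code {0F} {1F} (λ ()) 1 refl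
  idx : Fin 2 → Fin 3
  idx z = if does (z ≟ x) then 0F else 1F
  spells : ∀ z → lookup C (idx z) ≡ z ∷ []
  spells z with z ≟ x
  ... | yes refl = refl
  ... | no z≢x = cong (_∷ []) (sym (other-letter x≢y z≢x))
  not-two : ∀ w → 2F ∷ [] ≢ map idx w
  not-two (z ∷ w) e with z ≟ x | e
  ... | yes _ | ()
  ... | no _ | ()
  v₃-spelled : concatIdx C (2F ∷ []) ≡ concatIdx C (map idx v₃)
  v₃-spelled = trans (++-identityʳ v₃) (sym (concatIdx-spelling C idx spells v₃))

binary-1-1-not-UD : ∀ c (C : Seq 2 3) → ¬ UD 2 (1 ∷ᵥ 1 ∷ᵥ c ∷ᵥ []ᵥ) C
binary-1-1-not-UD c (v₁ ∷ᵥ v₂ ∷ᵥ v₃ ∷ᵥ []ᵥ) (lengths , code)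
  with x , refl ← length≡1⇒[x] {v = v₁} (lengths 0F) | y , refl ← length≡1⇒[x] {v = v₂} (lengths 1F) =
  binary-letters-not-code x y v₃ code

-- Counting codes with three words

module _ {n : ℕ} where

  NoForwardPrefix : Seq n 3 → Set
  NoForwardPrefix (v₁ ∷ᵥ v₂ ∷ᵥ v₃ ∷ᵥ []ᵥ) = ¬ IsPrefix v₁ v₂ × ¬ IsPrefix v₁ v₃ × ¬ IsPrefix v₂ v₃

  noForwardPrefix? : ∀ C → Dec (NoForwardPrefix C)
  noForwardPrefix? (v₁ ∷ᵥ v₂ ∷ᵥ v₃ ∷ᵥ []ᵥ) =
    ¬? (v₁ ⊑? v₂) ×-dec (¬? (v₁ ⊑? v₃) ×-dec ¬? (v₂ ⊑? v₃))

  sorted-no-forward-prefix⇒PR : ∀ {a b c} → 1 ≤ a → a ≤ b → b ≤ c → ∀ C →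
    HasLengths (a ∷ᵥ b ∷ᵥ c ∷ᵥ []ᵥ) C → NoForwardPrefix C → PR n (a ∷ᵥ b ∷ᵥ c ∷ᵥ []ᵥ) C
  sorted-no-forward-prefix⇒PR {a} 1≤a a≤b b≤c C@(v₁ ∷ᵥ v₂ ∷ᵥ v₃ ∷ᵥ []ᵥ) lengths
    (v₁⋢v₂ , v₁⋢v₃ , v₂⋢v₃) =
    lengths , (λ is js _ _ → prefix-free⇒unique-factorization C nonempty prefix-free is js) ,
    λ i j → mk⇔ (prefix-free i j) λ { refl → [] , ++-identityʳ _ }
    where
    a≤ : ∀ i → a ≤ length (lookup C i)
    a≤ 0F = ≤-reflexive (sym (lengths 0F))
    a≤ 1F = ≤-trans a≤b (≤-reflexive (sym (lengths 1F)))
    a≤ 2F = ≤-trans (≤-trans a≤b b≤c) (≤-reflexive (sym (lengths 2F)))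
    nonempty : ∀ i → lookup C i ≢ []
    nonempty i Cᵢ≡[] with () ← subst (λ w → 1 ≤ length w) Cᵢ≡[] (≤-trans 1≤a (a≤ i))
    |v₁|≤|v₂| : length v₁ ≤ length v₂
    |v₁|≤|v₂| = subst₂ _≤_ (sym (lengths 0F)) (sym (lengths 1F)) a≤b
    |v₂|≤|v₃| : length v₂ ≤ length v₃
    |v₂|≤|v₃| = subst₂ _≤_ (sym (lengths 1F)) (sym (lengths 2F)) b≤c
    prefix-free : ∀ i j → IsPrefix (lookup C i) (lookup C j) → i ≡ j
    prefix-free 0F 0F _ = refl
    prefix-free 0F 1F v₁⊑v₂ = ⊥-elim (v₁⋢v₂ v₁⊑v₂)
    prefix-free 0F 2F v₁⊑v₃ = ⊥-elim (v₁⋢v₃ v₁⊑v₃)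
    prefix-free 1F 0F v₂⊑v₁ = ⊥-elim (v₁⋢v₂ (⊑-reverse v₂⊑v₁ |v₁|≤|v₂|))
    prefix-free 1F 1F _ = refl
    prefix-free 1F 2F v₂⊑v₃ = ⊥-elim (v₂⋢v₃ v₂⊑v₃)
    prefix-free 2F 0F v₃⊑v₁ = ⊥-elim (v₁⋢v₃ (⊑-reverse v₃⊑v₁ (≤-trans |v₁|≤|v₂| |v₂|≤|v₃|)))
    prefix-free 2F 1F v₃⊑v₂ = ⊥-elim (v₂⋢v₃ (⊑-reverse v₃⊑v₂ |v₂|≤|v₃|))
    prefix-free 2F 2F _ = refl

  count-avoiding-two-prefixes : ∀ {a d} (u w : Word n) → length u ≡ a → length w ≡ a + d → ∀ e →
    n ^ (a + d + e) ∸ (n ^ (d + e) + n ^ e) ≤ Σ-words (a + d + e) (λ v → 𝟙 (¬? (u ⊑? v) ×-dec ¬? (w ⊑? v)))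
  count-avoiding-two-prefixes {a} {d} u w |u|≡a |w|≡a+d e = m≤n+o⇒m∸n≤o (n ^ c) _ (begin
    n ^ c
      ≡⟨ trans (Σ-words-const c 1) (*-identityʳ (n ^ c)) ⟨
    Σ-words c (λ _ → 1)
      ≤⟨ Σ-words-mono-≤ c (λ v _ → 𝟙-union-bound (u ⊑? v) (w ⊑? v)) ⟩
    Σ-words c (λ v → (𝟙 (u ⊑? v) + 𝟙 (w ⊑? v)) + avoid v)
      ≡⟨ Σ-words-distrib-+ c _ avoid ⟩
    Σ-words c (λ v → 𝟙 (u ⊑? v) + 𝟙 (w ⊑? v)) + Σ-words c avoid
      ≡⟨ cong (_+ Σ-words c avoid) (Σ-words-distrib-+ c _ _) ⟩
    (Σ-words c (𝟙 ∘ (u ⊑?_)) + Σ-words c (𝟙 ∘ (w ⊑?_))) + Σ-words c avoid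
      ≡⟨ cong (λ k → (k + _) + Σ-words c avoid) extensions-of-u ⟩
    (n ^ (d + e) + Σ-words c (𝟙 ∘ (w ⊑?_))) + Σ-words c avoid
      ≡⟨ cong (λ k → (n ^ (d + e) + k) + Σ-words c avoid) (count-⊑ w |w|≡a+d e) ⟩
    (n ^ (d + e) + n ^ e) + Σ-words c avoid ∎)
    where
    open ≤-Reasoning
    c = a + d + e
    avoid = λ v → 𝟙 (¬? (u ⊑? v) ×-dec ¬? (w ⊑? v))
    extensions-of-u : Σ-words c (𝟙 ∘ (u ⊑?_)) ≡ n ^ (d + e)
    extensions-of-u =
      subst (λ k → Σ-words k (𝟙 ∘ (u ⊑?_)) ≡ n ^ (d + e)) (sym (+-assoc a d e)) (count-⊑ u |u|≡a (d + e))

  count-no-forward-prefix : ∀ a d e →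
    n ^ a * ((n ^ (a + d) ∸ n ^ d) * (n ^ (a + d + e) ∸ (n ^ (d + e) + n ^ e)))
      ≤ Σ-seqs (a ∷ᵥ a + d ∷ᵥ a + d + e ∷ᵥ []ᵥ) (𝟙 ∘ noForwardPrefix?)
  count-no-forward-prefix a d e = begin
    n ^ a * (K₁ * K₀)                 ≡⟨ Σ-words-const a (K₁ * K₀) ⟨
    Σ-words a (λ _ → K₁ * K₀)         ≤⟨ Σ-words-mono-≤ a middle ⟩
    Σ-seqs (a ∷ᵥ b ∷ᵥ c ∷ᵥ []ᵥ) (𝟙 ∘ noForwardPrefix?) ∎
    where
    open ≤-Reasoning
    b = a + d
    c = a + d + e
    K₁ = n ^ b ∸ n ^ d
    K₀ = n ^ c ∸ (n ^ (d + e) + n ^ e)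
    inner : ∀ v₁ → length v₁ ≡ a → ∀ v₂ → length v₂ ≡ b →
      𝟙 (¬? (v₁ ⊑? v₂)) * K₀
        ≤ Σ-words c (λ v₃ → 𝟙 (noForwardPrefix? (v₁ ∷ᵥ v₂ ∷ᵥ v₃ ∷ᵥ []ᵥ)))
    inner v₁ |v₁|≡a v₂ |v₂|≡b = begin
      𝟙 v₁⋢v₂? * K₀
        ≤⟨ *-monoʳ-≤ (𝟙 v₁⋢v₂?) (count-avoiding-two-prefixes v₁ v₂ |v₁|≡a |v₂|≡b e) ⟩
      𝟙 v₁⋢v₂? * Σ-words c (λ v₃ → 𝟙 (avoid? v₃))
        ≡⟨ *-distribˡ-Σ-words c (𝟙 v₁⋢v₂?) _ ⟩
      Σ-words c (λ v₃ → 𝟙 v₁⋢v₂? * 𝟙 (avoid? v₃))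
        ≡⟨ Σ-words-cong c (λ v₃ _ → 𝟙-× v₁⋢v₂? (avoid? v₃)) ⟨
      Σ-words c (λ v₃ → 𝟙 (v₁⋢v₂? ×-dec avoid? v₃)) ∎
      where
      v₁⋢v₂? = ¬? (v₁ ⊑? v₂)
      avoid? = λ v₃ → ¬? (v₁ ⊑? v₃) ×-dec ¬? (v₂ ⊑? v₃)
    middle : ∀ v₁ → length v₁ ≡ a →
      K₁ * K₀
        ≤ Σ-words b (λ v₂ → Σ-words c (λ v₃ → 𝟙 (noForwardPrefix? (v₁ ∷ᵥ v₂ ∷ᵥ v₃ ∷ᵥ []ᵥ))))
    middle v₁ |v₁|≡a = begin
      K₁ * K₀                                        ≡⟨ cong (_* K₀) (count-⋢ v₁ |v₁|≡a d) ⟨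
      Σ-words b (λ v₂ → 𝟙 (¬? (v₁ ⊑? v₂))) * K₀       ≡⟨ *-comm _ K₀ ⟩
      K₀ * Σ-words b (λ v₂ → 𝟙 (¬? (v₁ ⊑? v₂)))       ≡⟨ *-distribˡ-Σ-words b K₀ _ ⟩
      Σ-words b (λ v₂ → K₀ * 𝟙 (¬? (v₁ ⊑? v₂)))       ≡⟨ Σ-words-cong b (λ v₂ _ → *-comm K₀ _) ⟩
      Σ-words b (λ v₂ → 𝟙 (¬? (v₁ ⊑? v₂)) * K₀)       ≤⟨ Σ-words-mono-≤ b (inner v₁ |v₁|≡a) ⟩
      Σ-words b (λ v₂ → Σ-words c (λ v₃ → 𝟙 (noForwardPrefix? (v₁ ∷ᵥ v₂ ∷ᵥ v₃ ∷ᵥ []ᵥ)))) ∎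

  NotPowersOfFirst : ℕ → ℕ → Seq n 3 → Set
  NotPowersOfFirst b c (v₁ ∷ᵥ v₂ ∷ᵥ v₃ ∷ᵥ []ᵥ) = v₂ ≢ v₁ ^ʷ b × v₃ ≢ v₁ ^ʷ c

  notPowersOfFirst? : ∀ b c C → Dec (NotPowersOfFirst b c C)
  notPowersOfFirst? b c (v₁ ∷ᵥ v₂ ∷ᵥ v₃ ∷ᵥ []ᵥ) = ¬? (v₂ ≟ʷ v₁ ^ʷ b) ×-dec ¬? (v₃ ≟ʷ v₁ ^ʷ c)

  code⇒notPowersOfFirst : ∀ b c C → IsCode C → NotPowersOfFirst b c C
  code⇒notPowersOfFirst b c C@(_ ∷ᵥ _ ∷ᵥ _ ∷ᵥ []ᵥ) code =
    code-word-not-power C code {0F} {1F} (λ ()) b , code-word-not-power C code {0F} {2F} (λ ()) c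

  count-not-powers-of-first : ∀ b c →
    Σ-seqs (1 ∷ᵥ b ∷ᵥ c ∷ᵥ []ᵥ) (𝟙 ∘ notPowersOfFirst? b c) ≡ n ^ 1 * ((n ^ c ∸ 1) * (n ^ b ∸ 1))
  count-not-powers-of-first b c =
    trans (Σ-words-cong 1 per-first-letter) (Σ-words-const {n} 1 ((n ^ c ∸ 1) * (n ^ b ∸ 1)))
    where
    per-first-letter : ∀ v₁ → length v₁ ≡ 1 →
      Σ-words b (λ v₂ → Σ-words c (λ v₃ → 𝟙 (notPowersOfFirst? b c (v₁ ∷ᵥ v₂ ∷ᵥ v₃ ∷ᵥ []ᵥ))))
        ≡ (n ^ c ∸ 1) * (n ^ b ∸ 1)
    per-first-letter v₁ |v₁|≡1 = begin
      Σ-words b (λ v₂ → Σ-words c (λ v₃ → 𝟙 (not-b? v₂ ×-dec not-c? v₃)))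
        ≡⟨ Σ-words-cong b (λ v₂ _ → Σ-words-cong c (λ v₃ _ → 𝟙-× (not-b? v₂) (not-c? v₃))) ⟩
      Σ-words b (λ v₂ → Σ-words c (λ v₃ → 𝟙 (not-b? v₂) * 𝟙 (not-c? v₃)))
        ≡⟨ Σ-words-cong b (λ v₂ _ → *-distribˡ-Σ-words c (𝟙 (not-b? v₂)) _) ⟨
      Σ-words b (λ v₂ → 𝟙 (not-b? v₂) * Σ-words c (𝟙 ∘ not-c?))
        ≡⟨ Σ-words-cong b (λ v₂ _ → cong (𝟙 (not-b? v₂) *_) (count-≢ (v₁ ^ʷ c) (|v₁^k| c))) ⟩
      Σ-words b (λ v₂ → 𝟙 (not-b? v₂) * (n ^ c ∸ 1))
        ≡⟨ Σ-words-cong b (λ v₂ _ → *-comm (𝟙 (not-b? v₂)) _) ⟩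
      Σ-words b (λ v₂ → (n ^ c ∸ 1) * 𝟙 (not-b? v₂))
        ≡⟨ *-distribˡ-Σ-words b (n ^ c ∸ 1) _ ⟨
      (n ^ c ∸ 1) * Σ-words b (𝟙 ∘ not-b?)
        ≡⟨ cong ((n ^ c ∸ 1) *_) (count-≢ (v₁ ^ʷ b) (|v₁^k| b)) ⟩
      (n ^ c ∸ 1) * (n ^ b ∸ 1) ∎
      where
      open ≡-Reasoning
      not-b? = λ v₂ → ¬? (v₂ ≟ʷ v₁ ^ʷ b)
      not-c? = λ v₃ → ¬? (v₃ ≟ʷ v₁ ^ʷ c)
      |v₁^k| : ∀ k → length (v₁ ^ʷ k) ≡ k
      |v₁^k| k = trans (length-^ʷ v₁ k) (trans (cong (k *_) |v₁|≡1) (*-identityʳ k))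

  codes-upper-bound : ∀ {m} (L : Vec ℕ m) {u} → HasCard (UD n L) u → u ≤ n ^ Vec.sum L
  codes-upper-bound L {u} #UD =
    subst (u ≤_) (Σ-seqs-1 L) (card-≤-Σ-seqs {L = L} (λ _ → yes tt) (λ _ (lengths , _) → lengths , tt) #UD)

  codes-upper-bound-letter : ∀ b c {u} → HasCard (UD n (1 ∷ᵥ b ∷ᵥ c ∷ᵥ []ᵥ)) u →
    u ≤ n ^ 1 * ((n ^ c ∸ 1) * (n ^ b ∸ 1))
  codes-upper-bound-letter b c {u} #UD = subst (u ≤_) (count-not-powers-of-first b c)
    (card-≤-Σ-seqs {L = 1 ∷ᵥ b ∷ᵥ c ∷ᵥ []ᵥ} (notPowersOfFirst? b c)
      (λ C (lengths , code) → lengths , code⇒notPowersOfFirst b c C code) #UD)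

  prefix-codes-lower-bound : ∀ a d e → 1 ≤ a →
    ∀ {p} → HasCard (PR n (a ∷ᵥ a + d ∷ᵥ a + d + e ∷ᵥ []ᵥ)) p →
    n ^ a * ((n ^ (a + d) ∸ n ^ d) * (n ^ (a + d + e) ∸ (n ^ (d + e) + n ^ e))) ≤ p
  prefix-codes-lower-bound a d e 1≤a #PR = ≤-trans (count-no-forward-prefix a d e)
    (Σ-seqs-≤-card {L = a ∷ᵥ a + d ∷ᵥ a + d + e ∷ᵥ []ᵥ} noForwardPrefix?
      (sorted-no-forward-prefix⇒PR 1≤a (m≤m+n a d) (m≤m+n (a + d) e)) #PR)

-- Permuting the code words

HasCard-↔ : ∀ {A B : Set} {S : A → Set} {T : B → Set} (e : A ↔ B) →
  (∀ x → S x → T (Inverse.to e x)) → (∀ y → T y → S (Inverse.from e y)) → ∀ {k} → HasCard S k → HasCard T k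
HasCard-↔ {S = S} {T} e S⊆T T⊆S (xs , xs! , ∈xs⇔S , |xs|≡k) =
  map to xs , Unique.map⁺ (Injection.injective (Inverse⇒Injection e)) xs! ,
  (λ y → mk⇔ (∈⇒T y) (T⇒∈ y)) , trans (length-map to xs) |xs|≡k
  where
  open Inverse e
  ∈⇒T : ∀ y → y ∈ map to xs → T y
  ∈⇒T y y∈ with x , x∈xs , refl ← ∈-map⁻ to y∈ = S⊆T x (Equivalence.to (∈xs⇔S x) x∈xs)
  T⇒∈ : ∀ y → T y → y ∈ map to xs
  T⇒∈ y Ty = subst (_∈ map to xs) (strictlyInverseˡ y) (∈-map⁺ to (Equivalence.from (∈xs⇔S (from y)) (T⊆S y Ty)))

reindex : ∀ {A : Set} {m} → Permutation′ m → Vec A m → Vec A m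
reindex π v = Vec.tabulate (λ i → lookup v (π ⟨$⟩ʳ i))

module _ {A : Set} {m : ℕ} where

  lookup-reindex : ∀ π (v : Vec A m) i → lookup (reindex π v) i ≡ lookup v (π ⟨$⟩ʳ i)
  lookup-reindex π v = Vec.lookup∘tabulate _

  reindex-flip : ∀ π (v : Vec A m) → reindex (Perm.flip π) (reindex π v) ≡ v
  reindex-flip π v = trans (Vec.tabulate-cong λ i → trans (lookup-reindex π v _) (cong (lookup v) (Perm.inverseʳ π)))
                           (Vec.tabulate∘lookup v)

  reindex-↔ : Permutation′ m → Vec A m ↔ Vec A m
  reindex-↔ π = mk↔ₛ′ (reindex π) (reindex (Perm.flip π)) (reindex-flip (Perm.flip π)) (reindex-flip π)

module _ {n m : ℕ} (π : Permutation′ m) where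

  concatIdx-reindex : ∀ (C : Seq n m) is → concatIdx (reindex π C) is ≡ concatIdx C (map (π ⟨$⟩ʳ_) is)
  concatIdx-reindex C [] = refl
  concatIdx-reindex C (i ∷ is) = cong₂ _++_ (lookup-reindex π C i) (concatIdx-reindex C is)

  HasLengths-reindex : ∀ {L : Vec ℕ m} {C : Seq n m} → HasLengths L C → HasLengths (reindex π L) (reindex π C)
  HasLengths-reindex {L} {C} lengths i =
    trans (cong length (lookup-reindex π C i)) (trans (lengths (π ⟨$⟩ʳ i)) (sym (lookup-reindex π L i)))

  IsCode-reindex : ∀ {C : Seq n m} → IsCode C → IsCode (reindex π C)
  IsCode-reindex {C} code is js is≢[] js≢[] eq =
    map-injective (Injection.injective (Inverse⇒Injection π))
      (code (map (π ⟨$⟩ʳ_) is) (map (π ⟨$⟩ʳ_) js) (map-≢[] is≢[]) (map-≢[] js≢[])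
        (trans (sym (concatIdx-reindex C is)) (trans eq (concatIdx-reindex C js))))
    where
    map-≢[] : ∀ {ks : List (Fin m)} → ks ≢ [] → map (π ⟨$⟩ʳ_) ks ≢ []
    map-≢[] {[]} ks≢[] = ⊥-elim (ks≢[] refl)
    map-≢[] {_ ∷ _} _ ()

  IsPrefixCode-reindex : ∀ {C : Seq n m} → IsPrefixCode C → IsPrefixCode (reindex π C)
  IsPrefixCode-reindex {C} (code , prefix⇔≡) = IsCode-reindex {C} code , λ i j → mk⇔
    (λ Cᵢ⊑Cⱼ → Injection.injective (Inverse⇒Injection π) (Equivalence.to (prefix⇔≡ _ _)
      (subst₂ IsPrefix (lookup-reindex π C i) (lookup-reindex π C j) Cᵢ⊑Cⱼ)))
    λ { refl → [] , ++-identityʳ _ }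

  UD-reindex : ∀ (L : Vec ℕ m) (C : Seq n m) → UD n L C → UD n (reindex π L) (reindex π C)
  UD-reindex L C (lengths , code) = HasLengths-reindex {L} {C} lengths , IsCode-reindex {C} code

  PR-reindex : ∀ (L : Vec ℕ m) (C : Seq n m) → PR n L C → PR n (reindex π L) (reindex π C)
  PR-reindex L C (lengths , prefix-code) = HasLengths-reindex {L} {C} lengths , IsPrefixCode-reindex {C} prefix-code

RatioBound : ∀ {m} → ℕ → Vec ℕ m → Set
RatioBound n L = ∃ (UD n L) → (p u : ℕ) → HasCard (PR n L) p → HasCard (UD n L) u → RatioExceedsAlpha n p u

RatioBound-reindex : ∀ {n m} (π : Permutation′ m) (L : Vec ℕ m) → RatioBound n (reindex π L) → RatioBound n L
RatioBound-reindex {n} π L bound (C , ud) p u #PR #UD =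
  bound (reindex π C , UD-reindex π L C ud) p u (transport (PR n) (PR-reindex π) (PR-reindex (Perm.flip π)) #PR)
                                            (transport (UD n) (UD-reindex π) (UD-reindex (Perm.flip π)) #UD)
  where
  transport : ∀ (S : Vec ℕ _ → Seq n _ → Set) →
    (∀ L C → S L C → S (reindex π L) (reindex π C)) →
    (∀ L C → S L C → S (reindex (Perm.flip π) L) (reindex (Perm.flip π) C)) →
    ∀ {k} → HasCard (S L) k → HasCard (S (reindex π L)) k
  transport S forth back = HasCard-↔ (reindex-↔ π) (forth L)
    (λ C SπL → subst (λ L′ → S L′ _) (reindex-flip π L) (back _ C SπL))

-- Arithmetic

-- With denominators cleared, α/β < (1 − 1/N)(1 − 1/N − 1/(ND)), the lower bound for ρ given by
-- count-no-forward-prefix and the trivial upper bound, where N = n^a, D = n^(b−a).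
PrefixRatioExceeds : ℕ → ℕ → ℕ → ℕ → Set
PrefixRatioExceeds α β N D = α * (N * N * D) + β * (N ∸ 1) < β * ((N ∸ 1) * ((N ∸ 1) * D))

ratio-from-counts : ∀ {α β N D E u p} → .{{NonZero N}} → .{{NonZero D}} → .{{NonZero E}} →
  PrefixRatioExceeds α β N D →
  u ≤ N * (N * D * (N * D * E)) →
  N * ((N * D ∸ D) * (N * D * E ∸ (D * E + E))) ≤ p →
  α * u < p * β
ratio-from-counts {α} {β} {N} {D} {E} {u} {p} exceeds u≤ ≤p = begin-strict
  α * u                                        ≤⟨ *-monoʳ-≤ α u≤ ⟩
  α * (N * (N * D * (N * D * E)))              ≡⟨ regroup-total α N D E ⟩
  NDE * (α * (N * N * D))                      <⟨ m+n≤o⇒m≤o∸n (suc (NDE * (α * (N * N * D)))) scaled ⟩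
  NDE * (β * (x * (x * D))) ∸ NDE * (β * x)    ≡⟨ cong₂ _∸_ (regroup-main β N D E x) (regroup-edge β N D E x) ⟨
  K * (x * D * E) ∸ K * E                      ≡⟨ *-distribˡ-∸ K (x * D * E) E ⟨
  K * (x * D * E ∸ E)                          ≡⟨ *-assoc β (N * (x * D)) _ ⟩
  β * (N * (x * D) * (x * D * E ∸ E))          ≡⟨ cong (β *_) (*-assoc N (x * D) _) ⟩
  β * (N * (x * D * (x * D * E ∸ E)))          ≡⟨ cong (λ t → β * (N * t)) (cong₂ _*_ xD≡ xDE∸E≡) ⟩
  β * (N * ((N * D ∸ D) * (N * D * E ∸ (D * E + E))))  ≤⟨ *-monoʳ-≤ β ≤p ⟩
  β * p                                        ≡⟨ *-comm β p ⟩
  p * β                                        ∎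
  where
  open ≤-Reasoning
  x = N ∸ 1
  NDE = N * D * E
  K = β * (N * (x * D))
  instance
    NDE≢0 : NonZero NDE
    NDE≢0 = m*n≢0 (N * D) E {{m*n≢0 N D}}
  scaled : NDE * (α * (N * N * D)) + NDE * (β * x) < NDE * (β * (x * (x * D)))
  scaled = subst (_< NDE * (β * (x * (x * D)))) (*-distribˡ-+ NDE _ _) (*-monoʳ-< NDE exceeds)
  xD≡ : x * D ≡ N * D ∸ D
  xD≡ = trans (*-distribʳ-∸ D N 1) (cong (N * D ∸_) (*-identityˡ D))
  xDE∸E≡ : x * D * E ∸ E ≡ N * D * E ∸ (D * E + E)
  xDE∸E≡ = begin-equality
    x * D * E ∸ E                ≡⟨ cong (λ t → t * E ∸ E) xD≡ ⟩
    (N * D ∸ D) * E ∸ E          ≡⟨ cong (_∸ E) (*-distribʳ-∸ E (N * D) D) ⟩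
    N * D * E ∸ D * E ∸ E        ≡⟨ ∸-+-assoc (N * D * E) (D * E) E ⟩
    N * D * E ∸ (D * E + E)      ∎
  regroup-total : ∀ α N D E → α * (N * (N * D * (N * D * E))) ≡ N * D * E * (α * (N * N * D))
  regroup-total = solve-∀
  regroup-main : ∀ β N D E x → β * (N * (x * D)) * (x * D * E) ≡ N * D * E * (β * (x * (x * D)))
  regroup-main = solve-∀
  regroup-edge : ∀ β N D E x → β * (N * (x * D)) * E ≡ N * D * E * (β * x)
  regroup-edge = solve-∀

<-by-excess : ∀ {a b} r → a + suc r ≡ b → a < b
<-by-excess {a} r refl = m<m+n a z<s

prefix-ratio-intro : ∀ {α β N D} x → N ∸ 1 ≡ x → α * (N * N * D) + β * x < β * (x * (x * D)) →
  PrefixRatioExceeds α β N D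
prefix-ratio-intro x refl exceeds = exceeds

prefix-ratio-large-alphabet : ∀ k {N D} → 6 + 2 * k ≤ N → 1 ≤ D → PrefixRatioExceeds (1 + k) (3 + k) N D
prefix-ratio-large-alphabet k 6+2k≤N 1≤D =
  let y , N≡ = m≤n⇒∃[o]m+o≡n 6+2k≤N ; s , D≡ = m≤n⇒∃[o]m+o≡n 1≤D in
  subst₂ (PrefixRatioExceeds (1 + k) (3 + k)) N≡ D≡
    (prefix-ratio-intro {1 + k} {3 + k} {6 + 2 * k + y} {1 + s} (5 + 2 * k + y) refl (<-by-excess _ (excess k y s)))
  where
  excess : ∀ k y s →
    (1 + k) * ((6 + 2 * k + y) * (6 + 2 * k + y) * (1 + s)) + (3 + k) * (5 + 2 * k + y)
      + suc (23 + 14 * k + 39 * s + 15 * y + 2 * k * k + 25 * k * s + 5 * k * y + 18 * s * y + 2 * y * y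
             + 4 * k * k * s + 6 * k * s * y + 2 * s * y * y)
      ≡ (3 + k) * ((5 + 2 * k + y) * ((5 + 2 * k + y) * (1 + s)))
  excess = solve-∀

prefix-ratio-large-alphabet-letter : ∀ k {D} → 3 + k ≤ D → PrefixRatioExceeds (1 + k) (3 + k) (3 + k) D
prefix-ratio-large-alphabet-letter k n≤D =
  let s , D≡ = m≤n⇒∃[o]m+o≡n n≤D in
  subst (PrefixRatioExceeds (1 + k) (3 + k) (3 + k)) D≡
    (prefix-ratio-intro {1 + k} {3 + k} {3 + k} {3 + k + s} (2 + k) refl (<-by-excess _ (excess k s)))
  where
  excess : ∀ k s →
    (1 + k) * ((3 + k) * (3 + k) * (3 + k + s)) + (3 + k) * (2 + k) + suc (2 + k + 3 * s + k * s)
      ≡ (3 + k) * ((2 + k) * ((2 + k) * (3 + k + s)))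
  excess = solve-∀

prefix-ratio-binary : ∀ {N D} → 4 ≤ N → 1 ≤ D → PrefixRatioExceeds 1 6 N D
prefix-ratio-binary 4≤N 1≤D =
  let y , N≡ = m≤n⇒∃[o]m+o≡n 4≤N ; s , D≡ = m≤n⇒∃[o]m+o≡n 1≤D in
  subst₂ (PrefixRatioExceeds 1 6) N≡ D≡
    (prefix-ratio-intro {1} {6} {4 + y} {1 + s} (3 + y) refl (<-by-excess _ (excess y s)))
  where
  excess : ∀ y s →
    1 * ((4 + y) * (4 + y) * (1 + s)) + 6 * (3 + y) + suc (19 + 38 * s + 22 * y + 28 * s * y + 5 * y * y + 5 * s * y * y)
      ≡ 6 * ((3 + y) * ((3 + y) * (1 + s)))
  excess = solve-∀

prefix-ratio-binary-letter : ∀ {D} → 4 ≤ D → PrefixRatioExceeds 1 6 2 D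
prefix-ratio-binary-letter 4≤D =
  let s , D≡ = m≤n⇒∃[o]m+o≡n 4≤D in
  subst (PrefixRatioExceeds 1 6 2) D≡ (prefix-ratio-intro {1} {6} {2} {4 + s} 1 refl (<-by-excess _ (excess s)))
  where
  excess : ∀ s → 1 * (2 * 2 * (4 + s)) + 6 * 1 + suc (1 + 2 * s) ≡ 6 * (1 * (1 * (4 + s)))
  excess = solve-∀

ratio-from-tight-counts : ∀ {α β M₁ M₂ T u p} →
  .{{NonZero α}} → .{{NonZero M₁}} → .{{NonZero M₂}} → .{{NonZero T}} →
  u ≤ M₁ * ((T ∸ 1) * M₂) → α * (M₁ * (T * M₂)) ≤ p * β → α * u < p * β
ratio-from-tight-counts {α} {β} {M₁} {M₂} {T} {u} {p} u≤ ≤p = begin-strict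
  α * u                       ≤⟨ *-monoʳ-≤ α u≤ ⟩
  α * (M₁ * ((T ∸ 1) * M₂))   <⟨ *-monoʳ-< α (*-monoʳ-< M₁ (*-monoˡ-< M₂ (∸-monoʳ-< z<s (>-nonZero⁻¹ T)))) ⟩
  α * (M₁ * (T * M₂))         ≤⟨ ≤p ⟩
  p * β                       ∎
  where open ≤-Reasoning

2*n≤n^[2+a] : ∀ n a → 2 ≤ n → 2 * n ≤ n ^ (2 + a)
2*n≤n^[2+a] n@(suc _) a 2≤n = begin
  2 * n             ≤⟨ *-monoˡ-≤ n 2≤n ⟩
  n * n             ≤⟨ *-monoʳ-≤ n (m≤m*n n (n ^ a) {{m^n≢0 n a}}) ⟩
  n * (n * n ^ a)   ∎
  where open ≤-Reasoning

-- The bound, case by case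

ratio-bound-from-counting : ∀ {n} .{{_ : NonZero n}} a d e → 1 ≤ a →
  PrefixRatioExceeds (alphaNum n) (alphaDen n) (n ^ a) (n ^ d) → RatioBound n (a ∷ᵥ a + d ∷ᵥ a + d + e ∷ᵥ []ᵥ)
ratio-bound-from-counting {n} a d e 1≤a exceeds _ p u #PR #UD =
  ratio-from-counts {alphaNum n} {alphaDen n} {{m^n≢0 n a}} {{m^n≢0 n d}} {{m^n≢0 n e}} exceeds u≤ ≤p
  where
  N = n ^ a
  D = n ^ d
  E = n ^ e
  n^[a+d] : n ^ (a + d) ≡ N * D
  n^[a+d] = ^-distribˡ-+-* n a d
  n^[a+d+e] : n ^ (a + d + e) ≡ N * D * E
  n^[a+d+e] = trans (^-distribˡ-+-* n (a + d) e) (cong (_* E) n^[a+d])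
  u≤ : u ≤ N * (N * D * (N * D * E))
  u≤ = subst (u ≤_) n^[a+b+c] (codes-upper-bound (a ∷ᵥ a + d ∷ᵥ a + d + e ∷ᵥ []ᵥ) #UD)
    where
    n^[a+b+c] : n ^ (a + (a + d + (a + d + e + 0))) ≡ N * (N * D * (N * D * E))
    n^[a+b+c] = trans (^-distribˡ-+-* n a _) (cong (N *_) (trans (^-distribˡ-+-* n (a + d) _)
      (cong₂ _*_ n^[a+d] (trans (cong (n ^_) (+-identityʳ (a + d + e))) n^[a+d+e]))))
  ≤p : N * ((N * D ∸ D) * (N * D * E ∸ (D * E + E))) ≤ p
  ≤p = subst (_≤ p) n^-regrouped (prefix-codes-lower-bound a d e 1≤a #PR)
    where
    n^-regrouped : N * ((n ^ (a + d) ∸ D) * (n ^ (a + d + e) ∸ (n ^ (d + e) + E)))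
                     ≡ N * ((N * D ∸ D) * (N * D * E ∸ (D * E + E)))
    n^-regrouped = trans (cong₂ (λ b c → N * ((b ∸ D) * (c ∸ (n ^ (d + e) + E)))) n^[a+d] n^[a+d+e])
                         (cong (λ de → N * ((N * D ∸ D) * (N * D * E ∸ (de + E)))) (^-distribˡ-+-* n d e))

ratio-bound-large-alphabet-1-1 : ∀ k e → RatioBound (3 + k) (1 ∷ᵥ 1 ∷ᵥ suc e ∷ᵥ []ᵥ)
ratio-bound-large-alphabet-1-1 k e _ p u #PR #UD =
  ratio-from-tight-counts {1 + k} {n} {n} {2 + k} {n * E} {u} {p} u≤ ≤p
  where
  n = 3 + k
  E = n ^ e
  instance
    nE≢0 : NonZero (n * E)
    nE≢0 = m*n≢0 n E {{_}} {{m^n≢0 n e}}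
  u≤ : u ≤ n * ((n * E ∸ 1) * (2 + k))
  u≤ = subst (u ≤_) (cong₂ (λ n₁ n₁′ → n₁ * ((n * E ∸ 1) * (n₁′ ∸ 1))) (*-identityʳ n) (*-identityʳ n))
             (codes-upper-bound-letter 1 (suc e) #UD)
  nE∸2E : n * E ∸ (E + E) ≡ (1 + k) * E
  nE∸2E = trans ([m+n]∸[m+o]≡n∸o E (E + (1 + k) * E) E) (m+n∸m≡n E ((1 + k) * E))
  ≤p : (1 + k) * (n * (n * E * (2 + k))) ≤ p * n
  ≤p = begin
    (1 + k) * (n * (n * E * (2 + k)))
      ≡⟨ regroup k E ⟩
    n * ((2 + k) * ((1 + k) * E)) * n
      ≡⟨ cong₂ (λ n₁ t → n₁ * ((n₁ ∸ 1) * t) * n) (*-identityʳ n) nE∸2E ⟨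
    n ^ 1 * ((n ^ 1 ∸ 1) * (n * E ∸ (E + E))) * n
      ≤⟨ *-monoˡ-≤ n (prefix-codes-lower-bound 1 0 e ≤-refl #PR) ⟩
    p * n ∎
    where
    open ≤-Reasoning
    regroup : ∀ k E → (1 + k) * ((3 + k) * ((3 + k) * E * (2 + k))) ≡ (3 + k) * ((2 + k) * ((1 + k) * E)) * (3 + k)
    regroup = solve-∀

ratio-bound-binary-1-2 : ∀ e → RatioBound 2 (1 ∷ᵥ 2 ∷ᵥ 2 + e ∷ᵥ []ᵥ)
ratio-bound-binary-1-2 e _ p u #PR #UD =
  ratio-from-tight-counts {1} {6} {2} {3} {4 * E} {u} {p} u≤ ≤p
  where
  E = 2 ^ e
  instance
    4·E≢0 : NonZero (4 * E)
    4·E≢0 = m*n≢0 4 E {{_}} {{m^n≢0 2 e}}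
  u≤ : u ≤ 2 * ((4 * E ∸ 1) * 3)
  u≤ = subst (λ T → u ≤ 2 * ((T ∸ 1) * 3)) (four-E E) (codes-upper-bound-letter 2 (2 + e) #UD)
    where
    four-E : ∀ E → 2 * (2 * E) ≡ 4 * E
    four-E = solve-∀
  4E∸3E : 2 * (2 * E) ∸ (2 * E + E) ≡ E
  4E∸3E = trans (cong (_∸ (2 * E + E)) (split E)) (m+n∸m≡n (2 * E + E) E)
    where
    split : ∀ E → 2 * (2 * E) ≡ 2 * E + E + E
    split = solve-∀
  ≤p : 1 * (2 * (4 * E * 3)) ≤ p * 6
  ≤p = begin
    1 * (2 * (4 * E * 3))                              ≡⟨ regroup E ⟩
    2 * (2 * E) * 6                                    ≡⟨ cong (λ t → 2 * (2 * t) * 6) 4E∸3E ⟨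
    2 * (2 * (2 * (2 * E) ∸ (2 * E + E))) * 6          ≤⟨ *-monoˡ-≤ 6 (prefix-codes-lower-bound 1 1 e ≤-refl #PR) ⟩
    p * 6                                              ∎
    where
    open ≤-Reasoning
    regroup : ∀ E → 1 * (2 * (4 * E * 3)) ≡ 2 * (2 * E) * 6
    regroup = solve-∀

ratio-bound-increments : ∀ n → 2 ≤ n → ∀ a d e → RatioBound n (a ∷ᵥ a + d ∷ᵥ a + d + e ∷ᵥ []ᵥ)
ratio-bound-increments n _ zero d e (C , lengths , code) =
  ⊥-elim (code-word-nonempty C code 0F (length≡0⇒[] (lengths 0F)))
ratio-bound-increments 0 () (suc _) _ _
ratio-bound-increments 1 (s≤s ()) (suc _) _ _
ratio-bound-increments 2 _ 1 zero e (C , ud) = ⊥-elim (binary-1-1-not-UD (1 + e) C ud)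
ratio-bound-increments 2 _ 1 1 e = ratio-bound-binary-1-2 e
ratio-bound-increments 2 _ 1 (suc (suc d)) e =
  ratio-bound-from-counting 1 (2 + d) e ≤-refl (prefix-ratio-binary-letter (2*n≤n^[2+a] 2 d ≤-refl))
ratio-bound-increments 2 _ (suc (suc a)) d e =
  ratio-bound-from-counting (2 + a) d e (s≤s z≤n) (prefix-ratio-binary (2*n≤n^[2+a] 2 a ≤-refl) (m^n>0 2 d))
ratio-bound-increments (suc (suc (suc k))) _ 1 zero e = ratio-bound-large-alphabet-1-1 k e
ratio-bound-increments (suc (suc (suc k))) _ 1 (suc d) e =
  ratio-bound-from-counting 1 (suc d) e ≤-refl
    (subst (λ N → PrefixRatioExceeds (1 + k) (3 + k) N ((3 + k) ^ suc d)) (sym (*-identityʳ (3 + k)))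
      (prefix-ratio-large-alphabet-letter k (m≤m*n (3 + k) ((3 + k) ^ d) {{m^n≢0 (3 + k) d}})))
ratio-bound-increments (suc (suc (suc k))) _ (suc (suc a)) d e =
  ratio-bound-from-counting (2 + a) d e (s≤s z≤n)
    (prefix-ratio-large-alphabet k
      (subst (_≤ (3 + k) ^ (2 + a)) (double k) (2*n≤n^[2+a] (3 + k) a (s≤s (s≤s z≤n))))
      (m^n>0 (3 + k) d))
  where
  double : ∀ k → 2 * (3 + k) ≡ 6 + 2 * k
  double = solve-∀

Sorted : Vec ℕ 3 → Set
Sorted (a ∷ᵥ b ∷ᵥ c ∷ᵥ []ᵥ) = a ≤ b × b ≤ c

ratio-bound-sorted : ∀ n → 2 ≤ n → ∀ L → Sorted L → RatioBound n L
ratio-bound-sorted n 2≤n (a ∷ᵥ b ∷ᵥ c ∷ᵥ []ᵥ) (a≤b , b≤c) =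
  subst (RatioBound n) (cong₂ (λ b c → a ∷ᵥ b ∷ᵥ c ∷ᵥ []ᵥ) a+[b∸a]≡b a+[b∸a]+[c∸b]≡c)
    (ratio-bound-increments n 2≤n a (b ∸ a) (c ∸ b))
  where
  a+[b∸a]≡b = m+[n∸m]≡n a≤b
  a+[b∸a]+[c∸b]≡c = trans (cong (_+ (c ∸ b)) a+[b∸a]≡b) (m+[n∸m]≡n b≤c)

sorting-permutation : ∀ L → ∃ λ π → Sorted (reindex π L)
sorting-permutation (x ∷ᵥ y ∷ᵥ z ∷ᵥ []ᵥ) with ≤-total x y | ≤-total y z | ≤-total x z
... | inj₁ x≤y | inj₁ y≤z | _        = Perm.id , x≤y , y≤z
... | inj₁ x≤y | inj₂ z≤y | inj₁ x≤z = Perm.transpose 1F 2F , x≤z , z≤y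
... | inj₁ x≤y | inj₂ z≤y | inj₂ z≤x = Perm.transpose 0F 1F Perm.∘ₚ Perm.transpose 1F 2F , z≤x , x≤y
... | inj₂ y≤x | inj₁ y≤z | inj₁ x≤z = Perm.transpose 0F 1F , y≤x , x≤z
... | inj₂ y≤x | inj₁ y≤z | inj₂ z≤x = Perm.transpose 1F 2F Perm.∘ₚ Perm.transpose 0F 1F , y≤z , z≤x
... | inj₂ y≤x | inj₂ z≤y | _        = Perm.transpose 0F 2F , z≤y , y≤x

theorem4 : (n : ℕ) → 2 ≤ n → (L : Vec ℕ 3) →
    ∃ (λ C → UD n L C) →
    (p u : ℕ) → HasCard (PR n L) p → HasCard (UD n L) u →
    RatioExceedsAlpha n p u
theorem4 n 2≤n L =
  let π , sorted = sorting-permutation L in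
  RatioBound-reindex π L (ratio-bound-sorted n 2≤n (reindex π L) sorted)
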